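{- Let $\ell$, $p$, $q$ be positive integers. Then every ordered bipartite graph with parts of sizes $p$ and $q$ that does not contain $K_{2,\ell}$ as an interval minor has at most $(\ell-1)(p-1)+q$ edges; that is, $m(p,q,\ell)=ex(p,q,K_{2,\ell})\leqslant (\ell-1)(p-1)+q$.
   Context: All graphs are simple. An ordered bipartite graph $(G;A,B)$ is a bipartite graph $G$ whose vertex set is partitioned into independent sets $A$ and $B$, each equipped with a linear order. Two vertices $u<v$ of the same part are consecutive if no vertex $w$ of that part satisfies $u<w<v$. Identifying two consecutive vertices $u,v$ replaces them by a single vertex $w$ (in their place in the order) whose neighbourhood is the union of the neighbourhoods of $u$ and $v$. Two ordered bipartite graphs are isomorphic if there is a graph isomorphism between them that maps parts to parts (possibly exchanging the two parts) and preserves both linear orders. An ordered bipartite graph $H$ is an interval minor of $G$ if a graph isomorphic to $H$ can be obtained from $G$ by repeatedly deleting edges and identifying consecutive vertices; otherwise $G$ is $H$-interval minor free. $ex(p,q,H)$ denotes the maximum number of edges of an ordered bipartite graph with parts of sizes $p$ and $q$ that is $H$-interval minor free, and $m(p,q,\ell)$ denotes $ex(p,q,K_{2,\ell})$, where $K_{r,s}$ is the complete bipartite graph (with any linear orders on its parts). -}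

module Defs where

open import Data.Nat as ℕ using (ℕ; zero; suc; _+_; _*_; _∸_)
open import Data.Bool using (Bool; true; false; _∧_; _∨_; not; if_then_else_)
open import Data.Fin as Fin using (Fin; zero; suc; pinch; _<_)
open import Data.Fin.Properties using (_≟_)
open import Data.Product using (Σ; _×_; _,_)
open import Data.Sum using (_⊎_)
open import Function.Bundles using (_⤖_; Bijection)
open import Relation.Nullary.Decidable using (⌊_⌋)
open import Relation.Binary.PropositionalEquality using (_≡_)

-- An ordered bipartite graph with parts A = Fin p and B = Fin q, each
-- linearly ordered by the natural order on Fin.  G a b ≡ true iff ab is an edge.
OBGraph : ℕ → ℕ → Set
OBGraph p q = Fin p → Fin q → Bool

anyFin : ∀ {n} → (Fin n → Bool) → Bool
anyFin {zero}  f = false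
anyFin {suc n} f = f zero ∨ anyFin (λ i → f (suc i))

countFin : ∀ {n} → (Fin n → Bool) → ℕ
countFin {zero}  f = 0
countFin {suc n} f = (if f zero then 1 else 0) + countFin (λ i → f (suc i))

edges : ∀ {p q} → OBGraph p q → ℕ
edges {zero}  G = 0
edges {suc p} G = countFin (G zero) + edges (λ a → G (suc a))

deleteEdge : ∀ {p q} → Fin p → Fin q → OBGraph p q → OBGraph p q
deleteEdge a b G a' b' = G a' b' ∧ not (⌊ a ≟ a' ⌋ ∧ ⌊ b ≟ b' ⌋)

-- Identifying the consecutive vertices i and i+1 of part A (resp. B):
-- the map  pinch i : Fin (suc n) → Fin n  sends i and i+1 to i and is the
-- order-preserving bijection elsewhere; the new vertex k is adjacent to b
-- iff some preimage of k is adjacent to b (union of neighbourhoods).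
identifyA : ∀ {p q} → Fin p → OBGraph (suc p) q → OBGraph p q
identifyA i G k b = anyFin (λ v → ⌊ pinch i v ≟ k ⌋ ∧ G v b)

identifyB : ∀ {p q} → Fin q → OBGraph p (suc q) → OBGraph p q
identifyB i G a k = anyFin (λ v → ⌊ pinch i v ≟ k ⌋ ∧ G a v)

data Reduces {p q} (G : OBGraph p q) : ∀ {p' q'} → OBGraph p' q' → Set where
  done  : Reduces G G
  del   : ∀ {p' q'} {H : OBGraph p' q'} → Reduces G H →
          (a : Fin p') (b : Fin q') → Reduces G (deleteEdge a b H)
  idA   : ∀ {p' q'} {H : OBGraph (suc p') q'} → Reduces G H →
          (i : Fin p') → Reduces G (identifyA i H)
  idB   : ∀ {p' q'} {H : OBGraph p' (suc q')} → Reduces G H →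
          (i : Fin q') → Reduces G (identifyB i H)

Monotone : ∀ {m n} → (Fin m → Fin n) → Set
Monotone f = ∀ i j → i < j → f i < f j

data Iso {p q p' q'} (G : OBGraph p q) (H : OBGraph p' q') : Set where
  straight : (f : Fin p ⤖ Fin p') (g : Fin q ⤖ Fin q') →
             Monotone (Bijection.to f) → Monotone (Bijection.to g) →
             (∀ a b → G a b ≡ H (Bijection.to f a) (Bijection.to g b)) →
             Iso G H
  swapped  : (f : Fin p ⤖ Fin q') (g : Fin q ⤖ Fin p') →
             Monotone (Bijection.to f) → Monotone (Bijection.to g) →
             (∀ a b → G a b ≡ H (Bijection.to g b) (Bijection.to f a)) →
             Iso G H

IntervalMinor : ∀ {r s p q} → OBGraph r s → OBGraph p q → Set
IntervalMinor {r} {s} {p} {q} H G =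
  Σ ℕ λ p' → Σ ℕ λ q' → Σ (OBGraph p' q') λ G' → Reduces G G' × Iso G' H

K : (r s : ℕ) → OBGraph r s
K r s a b = true

-- Induct on p.  If the first two vertices of A have at least ℓ common
-- neighbours, identifying all later vertices of A with the second one and then
-- merging B into ℓ intervals, each containing a common neighbour, yields
-- K_{2,ℓ}.  Otherwise identifying the first two vertices of A destroys exactly
-- as many edges as they have common neighbours, at most ℓ - 1, and the smaller
-- graph is still K_{2,ℓ}-interval minor free.

module Submission where

open import Defs
open import Data.Nat using (ℕ; zero; suc; _+_; _*_; _∸_; _≤_; z≤n; s≤s; s≤s⁻¹; _≤?_)
open import Data.Nat.Properties
  using (+-assoc; +-comm; +-identityʳ; *-suc; ≤-refl; ≤-trans; +-mono-≤; m≤n+m; m≤n⇒m≤1+n;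
         <⇒≱; ≰⇒>; +-commutativeSemigroup; module ≤-Reasoning)
open import Algebra.Properties.CommutativeSemigroup +-commutativeSemigroup
  using (interchange; xy∙z≈xz∙y)
open import Data.Bool using (Bool; true; false; _∧_; _∨_; if_then_else_)
open import Data.Bool.Properties using (∨-identityʳ; ∨-zeroʳ; ∨-assoc)
open import Data.Fin using (Fin; zero; suc; pinch)
open import Data.Fin.Properties using (_≟_; suc-injective)
open import Data.Product using (Σ; _×_; _,_)
open import Data.Empty using (⊥-elim)
open import Function using (_∘_)
open import Function.Construct.Identity using (⤖-id)
open import Relation.Nullary using (¬_; yes; no)
open import Relation.Nullary.Decidable using (⌊_⌋; ⌊⌋-map′)
open import Relation.Binary.PropositionalEquality

private variable
  n p q p′ q′ p″ q″ : ℕ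

infix 4 _≐_

_≐_ : OBGraph p q → OBGraph p q → Set
G ≐ H = ∀ a b → G a b ≡ H a b

≐-trans : {G H I : OBGraph p q} → G ≐ H → H ≐ I → G ≐ I
≐-trans G≐H H≐I a b = trans (G≐H a b) (H≐I a b)

transpose : OBGraph p q → OBGraph q p
transpose G b a = G a b

anyFin-false : ∀ n → anyFin {n} (λ _ → false) ≡ false
anyFin-false zero    = refl
anyFin-false (suc n) = anyFin-false n

anyFin-cong : {f g : Fin n → Bool} → (∀ i → f i ≡ g i) → anyFin f ≡ anyFin g
anyFin-cong {zero}  f≗g = refl
anyFin-cong {suc n} f≗g = cong₂ _∨_ (f≗g zero) (anyFin-cong (f≗g ∘ suc))

countFin-cong : {f g : Fin n → Bool} → (∀ i → f i ≡ g i) → countFin f ≡ countFin g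
countFin-cong {zero}  f≗g = refl
countFin-cong {suc n} f≗g =
  cong₂ (λ x y → (if x then 1 else 0) + y) (f≗g zero) (countFin-cong (f≗g ∘ suc))

edges-cong : {G H : OBGraph p q} → G ≐ H → edges G ≡ edges H
edges-cong {zero}  G≐H = refl
edges-cong {suc p} G≐H = cong₂ _+_ (countFin-cong (G≐H zero)) (edges-cong (G≐H ∘ suc))

⌊suc≟suc⌋ : (i k : Fin n) → ⌊ suc i ≟ suc k ⌋ ≡ ⌊ i ≟ k ⌋
⌊suc≟suc⌋ i k = ⌊⌋-map′ (cong suc) suc-injective (i ≟ k)

anyFin-select : (k : Fin n) (f : Fin n → Bool) → anyFin (λ v → ⌊ v ≟ k ⌋ ∧ f v) ≡ f k
anyFin-select {suc n} zero    f = trans (cong (f zero ∨_) (anyFin-false n)) (∨-identityʳ (f zero))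
anyFin-select {suc n} (suc k) f =
  trans (anyFin-cong (λ v → cong (_∧ f (suc v)) (⌊suc≟suc⌋ v k)))
        (anyFin-select k (f ∘ suc))

identifyA-zero-zero : (G : OBGraph (suc (suc p)) q) (b : Fin q) →
                      identifyA zero G zero b ≡ G zero b ∨ G (suc zero) b
identifyA-zero-zero {p} G b =
  cong (G zero b ∨_) (trans (cong (G (suc zero) b ∨_) (anyFin-false p)) (∨-identityʳ _))

identifyA-zero-suc : (G : OBGraph (suc (suc p)) q) (k : Fin p) (b : Fin q) →
                     identifyA zero G (suc k) b ≡ G (suc (suc k)) b
identifyA-zero-suc G k b = anyFin-select (suc k) (λ v → G (suc v) b)

identifyA-suc-zero : (G : OBGraph (suc (suc p)) q) (i : Fin p) (b : Fin q) →
                     identifyA (suc i) G zero b ≡ G zero b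
identifyA-suc-zero {p} G i b =
  trans (cong (G zero b ∨_) (anyFin-false (suc p))) (∨-identityʳ _)

identifyA-suc-suc : (G : OBGraph (suc (suc p)) q) (i k : Fin p) (b : Fin q) →
                    identifyA (suc i) G (suc k) b ≡ identifyA i (G ∘ suc) k b
identifyA-suc-suc G i k b =
  anyFin-cong (λ v → cong (_∧ G (suc v) b) (⌊suc≟suc⌋ (pinch i v) k))

identifyA-cong : (i : Fin p) {G H : OBGraph (suc p) q} → G ≐ H → identifyA i G ≐ identifyA i H
identifyA-cong i G≐H k b = anyFin-cong (λ v → cong (⌊ pinch i v ≟ k ⌋ ∧_) (G≐H v b))

-- identifyB i G is definitionally transpose (identifyA i (transpose G)), so the
-- facts about identifying vertices of B are those about A, transposed.

identifyB-zero-zero : (G : OBGraph p (suc (suc q))) (a : Fin p) →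
                      identifyB zero G a zero ≡ G a zero ∨ G a (suc zero)
identifyB-zero-zero G = identifyA-zero-zero (transpose G)

identifyB-zero-suc : (G : OBGraph p (suc (suc q))) (a : Fin p) (k : Fin q) →
                     identifyB zero G a (suc k) ≡ G a (suc (suc k))
identifyB-zero-suc G a k = identifyA-zero-suc (transpose G) k a

identifyB-suc-zero : (G : OBGraph p (suc (suc q))) (i : Fin q) (a : Fin p) →
                     identifyB (suc i) G a zero ≡ G a zero
identifyB-suc-zero G = identifyA-suc-zero (transpose G)

identifyB-suc-suc : (G : OBGraph p (suc (suc q))) (i : Fin q) (a : Fin p) (k : Fin q) →
                    identifyB (suc i) G a (suc k) ≡ identifyB i (λ a′ → G a′ ∘ suc) a k
identifyB-suc-suc G i a k = identifyA-suc-suc (transpose G) i k a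

identifyB-cong : (i : Fin q) {G H : OBGraph p (suc q)} → G ≐ H → identifyB i G ≐ identifyB i H
identifyB-cong i G≐H a k = identifyA-cong i (λ b a′ → G≐H a′ b) k a

identifyB-zero-⊇ : (G : OBGraph p (suc (suc q))) (a : Fin p) (b : Fin (suc q)) →
                   G a (suc b) ≡ true → identifyB zero G a b ≡ true
identifyB-zero-⊇ G a zero    edge =
  trans (identifyB-zero-zero G a) (trans (cong (G a zero ∨_) edge) (∨-zeroʳ _))
identifyB-zero-⊇ G a (suc k) edge = trans (identifyB-zero-suc G a k) edge

deleteEdge-cong : (a : Fin p) (b : Fin q) {G H : OBGraph p q} → G ≐ H →
                  deleteEdge a b G ≐ deleteEdge a b H
deleteEdge-cong a b G≐H a′ b′ = cong (λ x → x ∧ _) (G≐H a′ b′)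

Reduces-trans : {G : OBGraph p q} {H : OBGraph p′ q′} {I : OBGraph p″ q″} →
                Reduces G H → Reduces H I → Reduces G I
Reduces-trans G→H done          = G→H
Reduces-trans G→H (del H→I a b) = del (Reduces-trans G→H H→I) a b
Reduces-trans G→H (idA H→I i)   = idA (Reduces-trans G→H H→I) i
Reduces-trans G→H (idB H→I i)   = idB (Reduces-trans G→H H→I) i

IntervalMinor-identifyA : {r s : ℕ} {H : OBGraph r s} (i : Fin p) {G : OBGraph (suc p) q} →
                          IntervalMinor H (identifyA i G) → IntervalMinor H G
IntervalMinor-identifyA i (p′ , q′ , G′ , G→G′ , G′≅H) =
  p′ , q′ , G′ , Reduces-trans (idA done i) G→G′ , G′≅H

-- Reduction up to pointwise equality: identifying vertices computes adjacency
-- by a search over Fin, so Reduces reaches the intended graphs only pointwise.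

infix 4 _↠_

_↠_ : OBGraph p q → OBGraph p′ q′ → Set
_↠_ {p′ = p′} {q′ = q′} G H = Σ (OBGraph p′ q′) λ G′ → Reduces G G′ × G′ ≐ H

≐⇒↠ : {G H : OBGraph p q} → G ≐ H → G ↠ H
≐⇒↠ G≐H = _ , done , G≐H

↠-identifyA : (i : Fin p) {G : OBGraph (suc p) q} → G ↠ identifyA i G
↠-identifyA i = _ , idA done i , λ _ _ → refl

↠-identifyB : (i : Fin q) {G : OBGraph p (suc q)} → G ↠ identifyB i G
↠-identifyB i = _ , idB done i , λ _ _ → refl

Reduces-respˡ-≐ : {G G′ : OBGraph p q} {H : OBGraph p′ q′} → G ≐ G′ → Reduces G′ H → G ↠ H
Reduces-respˡ-≐ G≐G′ done = ≐⇒↠ G≐G′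
Reduces-respˡ-≐ G≐G′ (del G′→H a b) with Reduces-respˡ-≐ G≐G′ G′→H
... | X , G→X , X≐H = _ , del G→X a b , deleteEdge-cong a b X≐H
Reduces-respˡ-≐ G≐G′ (idA G′→H i) with Reduces-respˡ-≐ G≐G′ G′→H
... | X , G→X , X≐H = _ , idA G→X i , identifyA-cong i X≐H
Reduces-respˡ-≐ G≐G′ (idB G′→H i) with Reduces-respˡ-≐ G≐G′ G′→H
... | X , G→X , X≐H = _ , idB G→X i , identifyB-cong i X≐H

↠-trans : {G : OBGraph p q} {H : OBGraph p′ q′} {I : OBGraph p″ q″} → G ↠ H → H ↠ I → G ↠ I
↠-trans (X , G→X , X≐H) (Y , H→Y , Y≐I) with Reduces-respˡ-≐ X≐H H→Y
... | Z , X→Z , Z≐Y = Z , Reduces-trans G→X X→Z , ≐-trans Z≐Y Y≐I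

↠⇒IntervalMinor : {G : OBGraph p q} {H : OBGraph p′ q′} → G ↠ H → IntervalMinor H G
↠⇒IntervalMinor (G′ , G→G′ , G′≐H) =
  _ , _ , G′ , G→G′ , straight (⤖-id _) (⤖-id _) (λ _ _ i<j → i<j) (λ _ _ i<j → i<j) G′≐H

mergeRows : OBGraph (suc (suc n)) q → OBGraph 2 q
mergeRows G zero       b = G zero b
mergeRows G (suc zero) b = anyFin (λ a → G (suc a) b)

↠-mergeRows : (G : OBGraph (suc (suc n)) q) → G ↠ mergeRows G
↠-mergeRows {zero} G = ≐⇒↠ G≐merged
  where
  G≐merged : G ≐ mergeRows G
  G≐merged zero       b = refl
  G≐merged (suc zero) b = sym (∨-identityʳ _)
↠-mergeRows {suc n} G =
  ↠-trans (↠-identifyA (suc zero)) (↠-trans (↠-mergeRows (identifyA (suc zero) G)) (≐⇒↠ same))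
  where
  same : mergeRows (identifyA (suc zero) G) ≐ mergeRows G
  same zero       b = identifyA-suc-zero G zero b
  same (suc zero) b =
    trans (cong₂ _∨_ (trans (identifyA-suc-suc G zero zero b) (identifyA-zero-zero (G ∘ suc) b))
                     (anyFin-cong λ a → trans (identifyA-suc-suc G zero (suc a) b)
                                              (identifyA-zero-suc (G ∘ suc) a b)))
          (∨-assoc (G (suc zero) b) (G (suc (suc zero)) b) _)

data ColumnMerges {p} : OBGraph p q → OBGraph p q′ → Set where
  pointwise : {G H : OBGraph p q} → G ≐ H → ColumnMerges G H
  merge     : {G : OBGraph p (suc q)} {H : OBGraph p q′} (i : Fin q) →
              ColumnMerges (identifyB i G) H → ColumnMerges G H

ColumnMerges⇒↠ : {G : OBGraph p q} {H : OBGraph p q′} → ColumnMerges G H → G ↠ H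
ColumnMerges⇒↠ (pointwise G≐H) = ≐⇒↠ G≐H
ColumnMerges⇒↠ (merge i G→H)   = ↠-trans (↠-identifyB i) (ColumnMerges⇒↠ G→H)

ColumnMerges-respˡ-≐ : {G G′ : OBGraph p q} {H : OBGraph p q′} →
                       G ≐ G′ → ColumnMerges G′ H → ColumnMerges G H
ColumnMerges-respˡ-≐ G≐G′ (pointwise G′≐H) = pointwise (≐-trans G≐G′ G′≐H)
ColumnMerges-respˡ-≐ G≐G′ (merge i G′→H)   =
  merge i (ColumnMerges-respˡ-≐ (identifyB-cong i G≐G′) G′→H)

ColumnMerges-respʳ-≐ : {G : OBGraph p q} {H H′ : OBGraph p q′} →
                       ColumnMerges G H → H ≐ H′ → ColumnMerges G H′
ColumnMerges-respʳ-≐ (pointwise G≐H) H≐H′ = pointwise (≐-trans G≐H H≐H′)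
ColumnMerges-respʳ-≐ (merge i G→H)   H≐H′ = merge i (ColumnMerges-respʳ-≐ G→H H≐H′)

prependColumn : (Fin p → Bool) → OBGraph p q → OBGraph p (suc q)
prependColumn column G a zero    = column a
prependColumn column G a (suc b) = G a b

ColumnMerges-prepend : (column : Fin p → Bool) {G : OBGraph p q} {H : OBGraph p q′} →
                       ColumnMerges G H →
                       ColumnMerges (prependColumn column G) (prependColumn column H)
ColumnMerges-prepend column (pointwise G≐H) = pointwise λ { a zero → refl ; a (suc b) → G≐H a b }
ColumnMerges-prepend column {G} (merge i G→H) =
  merge (suc i) (ColumnMerges-respˡ-≐ shifted (ColumnMerges-prepend column G→H))
  where
  shifted : identifyB (suc i) (prependColumn column G) ≐ prependColumn column (identifyB i G)
  shifted a zero    = identifyB-suc-zero (prependColumn column G) i a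
  shifted a (suc k) = identifyB-suc-suc (prependColumn column G) i a k

ColumnMerges-K1 : (G : OBGraph p (suc q)) → (∀ a → G a zero ≡ true) → ColumnMerges G (K p 1)
ColumnMerges-K1 {q = zero}  G full = pointwise λ { a zero → full a }
ColumnMerges-K1 {q = suc q} G full =
  merge zero (ColumnMerges-K1 (identifyB zero G)
    λ a → trans (identifyB-zero-zero G a) (cong (_∨ G a (suc zero)) (full a)))

common : OBGraph (suc (suc n)) q → Fin q → Bool
common G b = G zero b ∧ G (suc zero) b

∧≡true⇒ : {x y : Bool} → x ∧ y ≡ true → x ≡ true × y ≡ true
∧≡true⇒ {true} {true} _ = refl , refl

common-adjacent : (G : OBGraph 2 q) {b : Fin q} → common G b ≡ true → ∀ a → G a b ≡ true
common-adjacent G both zero       with ∧≡true⇒ both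
... | edge , _ = edge
common-adjacent G both (suc zero) with ∧≡true⇒ both
... | _ , edge = edge

common-mergeRows : (G : OBGraph (suc (suc n)) q) {b : Fin q} →
                   common G b ≡ true → common (mergeRows G) b ≡ true
common-mergeRows G {b} both with ∧≡true⇒ {G zero b} both
... | edge₀ , edge₁ = cong₂ _∧_ edge₀ (cong (_∨ anyFin (λ a → G (suc (suc a)) b)) edge₁)

countFin≤ : (f : Fin n → Bool) → countFin f ≤ n
countFin≤ {zero}  f = z≤n
countFin≤ {suc n} f with f zero
... | true  = s≤s (countFin≤ (f ∘ suc))
... | false = m≤n⇒m≤1+n (countFin≤ (f ∘ suc))

countFin-mono : {f g : Fin n → Bool} → (∀ i → f i ≡ true → g i ≡ true) →
                countFin f ≤ countFin g
countFin-mono {zero}          f⊆g = z≤n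
countFin-mono {suc n} {f} {g} f⊆g =
  +-mono-≤ (ind-mono (f zero) (g zero) (f⊆g zero)) (countFin-mono (f⊆g ∘ suc))
  where
  ind-mono : ∀ x y → (x ≡ true → y ≡ true) → (if x then 1 else 0) ≤ (if y then 1 else 0)
  ind-mono false y x⇒y = z≤n
  ind-mono true  y x⇒y rewrite x⇒y refl = ≤-refl

countFin-∨-∧ : (f g : Fin n → Bool) →
               countFin f + countFin g ≡ countFin (λ i → f i ∨ g i) + countFin (λ i → f i ∧ g i)
countFin-∨-∧ {zero}  f g = refl
countFin-∨-∧ {suc n} f g =
  trans (interchange (ind (f zero)) _ (ind (g zero)) _)
        (trans (cong₂ _+_ (ind-∨-∧ (f zero) (g zero)) (countFin-∨-∧ (f ∘ suc) (g ∘ suc)))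
               (interchange (ind (f zero ∨ g zero)) _ _ _))
  where
  ind : Bool → ℕ
  ind x = if x then 1 else 0
  ind-∨-∧ : ∀ x y → ind x + ind y ≡ ind (x ∨ y) + ind (x ∧ y)
  ind-∨-∧ true  true  = refl
  ind-∨-∧ true  false = refl
  ind-∨-∧ false true  = refl
  ind-∨-∧ false false = refl

edges-identifyA-zero : (G : OBGraph (suc (suc p)) q) →
                       edges G ≡ edges (identifyA zero G) + countFin (common G)
edges-identifyA-zero G = begin
  countFin (G zero) + (countFin (G (suc zero)) + rest)
    ≡⟨ +-assoc (countFin (G zero)) _ rest ⟨
  (countFin (G zero) + countFin (G (suc zero))) + rest
    ≡⟨ cong (_+ rest) (countFin-∨-∧ (G zero) (G (suc zero))) ⟩
  (countFin (λ b → G zero b ∨ G (suc zero) b) + countFin (common G)) + rest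
    ≡⟨ xy∙z≈xz∙y _ (countFin (common G)) rest ⟩
  (countFin (λ b → G zero b ∨ G (suc zero) b) + rest) + countFin (common G)
    ≡⟨ cong (_+ countFin (common G)) merged ⟨
  edges (identifyA zero G) + countFin (common G) ∎
  where
  open ≡-Reasoning
  rest : ℕ
  rest = edges (λ a → G (suc (suc a)))
  merged : edges (identifyA zero G) ≡ countFin (λ b → G zero b ∨ G (suc zero) b) + rest
  merged = cong₂ _+_ (countFin-cong (identifyA-zero-zero G)) (edges-cong (identifyA-zero-suc G))

-- A first column that is not common is absorbed into the next one; a common one
-- is kept, or absorbs all the others once a single column is left to produce.
ColumnMerges-K2 : (ℓ : ℕ) (G : OBGraph 2 q) → suc ℓ ≤ countFin (common G) →
                  ColumnMerges G (K 2 (suc ℓ))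
ColumnMerges-K2 {zero}  ℓ G ()
ColumnMerges-K2 {suc q} ℓ G ℓ<c with common G zero in first
ColumnMerges-K2 {suc q} zero    G _   | true = ColumnMerges-K1 G (common-adjacent G first)
ColumnMerges-K2 {suc q} (suc ℓ) G ℓ<c | true =
  ColumnMerges-respˡ-≐ head∷tail
    (ColumnMerges-respʳ-≐ (ColumnMerges-prepend (λ a → G a zero) rest) K-extended)
  where
  head∷tail : G ≐ prependColumn (λ a → G a zero) (λ a → G a ∘ suc)
  head∷tail a zero    = refl
  head∷tail a (suc b) = refl
  rest : ColumnMerges (λ a → G a ∘ suc) (K 2 (suc ℓ))
  rest = ColumnMerges-K2 ℓ (λ a → G a ∘ suc) (s≤s⁻¹ ℓ<c)
  K-extended : prependColumn (λ a → G a zero) (K 2 (suc ℓ)) ≐ K 2 (suc (suc ℓ))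
  K-extended a zero    = common-adjacent G first a
  K-extended a (suc b) = refl
ColumnMerges-K2 {suc zero}    ℓ G ()  | false
ColumnMerges-K2 {suc (suc q)} ℓ G ℓ<c | false =
  merge zero (ColumnMerges-K2 ℓ (identifyB zero G) (≤-trans ℓ<c (countFin-mono still-common)))
  where
  still-common : ∀ b → common G (suc b) ≡ true → common (identifyB zero G) b ≡ true
  still-common b both =
    cong₂ _∧_ (identifyB-zero-⊇ G zero b (common-adjacent G both zero))
              (identifyB-zero-⊇ G (suc zero) b (common-adjacent G both (suc zero)))

K2-minor : (ℓ : ℕ) (G : OBGraph (suc (suc n)) q) → suc ℓ ≤ countFin (common G) →
           IntervalMinor (K 2 (suc ℓ)) G
K2-minor ℓ G ℓ<c = ↠⇒IntervalMinor (↠-trans (↠-mergeRows G) (ColumnMerges⇒↠ two-rows))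
  where
  two-rows : ColumnMerges (mergeRows G) (K 2 (suc ℓ))
  two-rows = ColumnMerges-K2 ℓ (mergeRows G)
               (≤-trans ℓ<c (countFin-mono λ b → common-mergeRows G {b}))

edges-bound : (ℓ p q : ℕ) (G : OBGraph (suc p) q) → ¬ IntervalMinor (K 2 (suc ℓ)) G →
              edges G ≤ ℓ * p + q
edges-bound ℓ zero q G _ = begin
  countFin (G zero) + 0 ≡⟨ +-identityʳ _ ⟩
  countFin (G zero)     ≤⟨ countFin≤ (G zero) ⟩
  q                     ≤⟨ m≤n+m q (ℓ * 0) ⟩
  ℓ * 0 + q             ∎
  where open ≤-Reasoning
edges-bound ℓ (suc p) q G free with countFin (common G) ≤? ℓ
... | no  c≰ℓ = ⊥-elim (free (K2-minor ℓ G (≰⇒> c≰ℓ)))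
... | yes c≤ℓ = begin
  edges G                                        ≡⟨ edges-identifyA-zero G ⟩
  edges (identifyA zero G) + countFin (common G) ≤⟨ +-mono-≤ smaller c≤ℓ ⟩
  ℓ * p + q + ℓ                                  ≡⟨ xy∙z≈xz∙y (ℓ * p) q ℓ ⟩
  ℓ * p + ℓ + q                                  ≡⟨ cong (_+ q) ℓ*p+ℓ≡ℓ*[1+p] ⟩
  ℓ * suc p + q                                  ∎
  where
  open ≤-Reasoning
  ℓ*p+ℓ≡ℓ*[1+p] : ℓ * p + ℓ ≡ ℓ * suc p
  ℓ*p+ℓ≡ℓ*[1+p] = trans (+-comm (ℓ * p) ℓ) (sym (*-suc ℓ p))
  smaller : edges (identifyA zero G) ≤ ℓ * p + q
  smaller = edges-bound ℓ p q (identifyA zero G)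
              (λ minor → free (IntervalMinor-identifyA zero minor))

lemma2p1 : (ℓ p q : ℕ) → 1 ≤ ℓ → 1 ≤ p → 1 ≤ q →
    (G : OBGraph p q) → ¬ IntervalMinor (K 2 ℓ) G →
    edges G ≤ (ℓ ∸ 1) * (p ∸ 1) + q
lemma2p1 (suc ℓ) (suc p) q _ _ _ G = edges-bound ℓ p q G
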